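{- Let $A$ be a formula, let $X$ be the set of variables occurring in $A$, and let $X_0,X_1,\ldots,X_k$ be an enumeration of all subsets of $X$ such that $X_i\subseteq X_j$ implies $i\ge j$. For $Y\subseteq X$ let $\theta^Y_A$ be the substitution with $\theta^Y_A(x)=A\to x$ for variables $x\in Y$ and $\theta^Y_A(x)=A\wedge x$ for variables $x\notin Y$ (parameters fixed), and let $\theta_A:=\theta^{X_0}_A\circ\theta^{X_1}_A\circ\cdots\circ\theta^{X_k}_A$. If $\mathcal{K}$ is a Kripke model with $\mathcal{K}\Vdash^-\theta_A(A)$ and $\mathcal{K}'$ is a ${\sf par}$-variant of $\mathcal{K}$ with $\mathcal{K}'\Vdash\theta_A(A)$, then $\mathcal{K}\Vdash\theta_A(A)$.
   Context: Formulas are built from atoms ${\sf var}\cup{\sf par}$ (variables and parameters) with $\bot,\wedge,\vee,\to$, interpreted intuitionistically. Substitutions commute with connectives and fix parameters; $\circ$ is composition. Kripke models are finite rooted intuitionistic Kripke models with persistent valuations. $\mathcal{K}\Vdash B$ means $B$ is forced at every node; $\mathcal{K}\Vdash^- B$ means $B$ is forced at every node other than the root. $\mathcal{K}'$ is a ${\sf par}$-variant of $\mathcal{K}$ if they have the same frame, the same valuation at every non-root node, and the root forces the same parameters in both. -}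

module Defs where

open import Data.Nat using (ℕ; suc)
open import Data.Bool using (Bool; true; false; if_then_else_)
open import Data.Fin using (Fin) renaming (_≤_ to _≤ᶠ_)
open import Data.List using (List; []; _∷_; _++_; foldr; map; tabulate)
open import Data.List.Membership.Propositional using (_∈_)
open import Data.Product using (_×_; ∃)
open import Data.Sum using (_⊎_)
open import Data.Empty renaming (⊥ to Empty)
open import Relation.Binary.PropositionalEquality using (_≡_; _≢_)

data Fm : Set where
  var : ℕ → Fm
  par : ℕ → Fm
  ⊥'  : Fm
  _∧'_ _∨'_ _⇒_ : Fm → Fm → Fm

infixr 6 _∧'_
infixr 5 _∨'_
infixr 4 _⇒_

vars : Fm → List ℕ
vars (var x)   = x ∷ []
vars (par _)   = []
vars ⊥'        = []
vars (A ∧' B)  = vars A ++ vars B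
vars (A ∨' B)  = vars A ++ vars B
vars (A ⇒ B)   = vars A ++ vars B

Sub : Set
Sub = ℕ → Fm

sub : Sub → Fm → Fm
sub σ (var x)  = σ x
sub σ (par p)  = par p
sub σ ⊥'       = ⊥'
sub σ (A ∧' B) = sub σ A ∧' sub σ B
sub σ (A ∨' B) = sub σ A ∨' sub σ B
sub σ (A ⇒ B)  = sub σ A ⇒ sub σ B

idSub : Sub
idSub = var

_∘ₛ_ : Sub → Sub → Sub
(σ ∘ₛ τ) x = sub σ (τ x)

VarSet : Set
VarSet = ℕ → Bool

_⊆ᵥ_ : VarSet → VarSet → Set
Y ⊆ᵥ Z = ∀ x → Y x ≡ true → Z x ≡ true

SubsetOfVars : VarSet → Fm → Set
SubsetOfVars Y A = ∀ x → Y x ≡ true → x ∈ vars A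

θ^ : VarSet → Fm → Sub
θ^ Y A x = if Y x then (A ⇒ var x) else (A ∧' var x)

θ : (A : Fm) (k : ℕ) → (Fin (suc k) → VarSet) → Sub
θ A k Xs = foldr _∘ₛ_ idSub (tabulate (λ i → θ^ (Xs i) A))

IsSubsetEnum : (A : Fm) (k : ℕ) → (Fin (suc k) → VarSet) → Set
IsSubsetEnum A k Xs =
  (∀ i → SubsetOfVars (Xs i) A) ×
  (∀ (Y : VarSet) → SubsetOfVars Y A → ∃ λ i → ∀ x → Xs i x ≡ Y x) ×
  (∀ i j → Xs i ⊆ᵥ Xs j → j ≤ᶠ i)

record Frame : Set where
  field
    size    : ℕ
    R       : Fin size → Fin size → Bool
    reflR   : ∀ w → R w w ≡ true
    transR  : ∀ u v w → R u v ≡ true → R v w ≡ true → R u w ≡ true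
    antisym : ∀ u v → R u v ≡ true → R v u ≡ true → u ≡ v
    root    : Fin size
    rootMin : ∀ w → R root w ≡ true

open Frame public

Node : Frame → Set
Node F = Fin (size F)

record Model (F : Frame) : Set where
  field
    vval : ℕ → Node F → Bool
    pval : ℕ → Node F → Bool
    vpers : ∀ x u v → R F u v ≡ true → vval x u ≡ true → vval x v ≡ true
    ppers : ∀ p u v → R F u v ≡ true → pval p u ≡ true → pval p v ≡ true

open Model public

infix 2 _∣_⊩_
_∣_⊩_ : {F : Frame} → Model F → Node F → Fm → Set
K ∣ w ⊩ var x  = vval K x w ≡ true
K ∣ w ⊩ par p  = pval K p w ≡ true
K ∣ w ⊩ ⊥'     = Empty
K ∣ w ⊩ A ∧' B = (K ∣ w ⊩ A) × (K ∣ w ⊩ B)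
K ∣ w ⊩ A ∨' B = (K ∣ w ⊩ A) ⊎ (K ∣ w ⊩ B)
_∣_⊩_ {F} K w (A ⇒ B) = ∀ v → R F w v ≡ true → K ∣ v ⊩ A → K ∣ v ⊩ B

_⊩_ : {F : Frame} → Model F → Fm → Set
_⊩_ {F} K B = ∀ (w : Node F) → K ∣ w ⊩ B

_⊩⁻_ : {F : Frame} → Model F → Fm → Set
_⊩⁻_ {F} K B = ∀ (w : Node F) → w ≢ root F → K ∣ w ⊩ B

ParVariant : {F : Frame} → Model F → Model F → Set
ParVariant {F} K K' =
  (∀ (w : Node F) → w ≢ root F →
     (∀ x → vval K' x w ≡ vval K x w) × (∀ p → pval K' p w ≡ pval K p w)) ×
  (∀ p → pval K' p (root F) ≡ pval K p (root F))

-- Read semantically, a substitution σ transforms a valuation V into V⟨σ⟩, where x holds at w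
-- iff σ x is forced at w; so θ_A(A) is forced at the root iff A is forced there after the
-- valuation has passed through θ^{X_0}, θ^{X_1}, …, θ^{X_k} in turn. Every θ^Z_A leaves the
-- valuation unchanged wherever A is forced, so once A holds at the root it keeps holding.
-- If A fails at the root of both K and K', then a single step θ^Z_A already makes the two
-- valuations agree, because at the root A ∧ x fails and A → x depends only on the other nodes.
-- If A fails at the root of K but holds at the root of K', the step for Z = {x ∈ X | K' ⊩ x at
-- the root} copies the root of K' onto K (until then K keeps agreeing with K' off the root, as
-- the steps do not change K'), and from that step on A holds at the root.
module Submission where

open import Defs
open import Data.Nat using (ℕ; suc)
open import Data.Bool using (Bool; true; false; _∧_)
open import Data.Bool.Properties using (_≟_)
open import Data.Fin using (Fin; zero)
open import Data.Fin.Properties using (all?) renaming (_≟_ to _≟ᶠ_)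
open import Data.List using (List; []; _∷_; foldr; foldl; map; tabulate)
open import Data.List.Properties using (map-tabulate)
open import Data.List.Membership.Propositional using (_∈_)
open import Data.List.Membership.Propositional.Properties using (∈-++⁺ˡ; ∈-++⁺ʳ)
open import Data.List.Membership.DecPropositional Data.Nat._≟_ using (_∈?_)
open import Data.List.Relation.Unary.Any using (Any; here; there)
open import Data.List.Relation.Unary.Any.Properties using (tabulate⁺)
open import Data.Product using (_×_; ∃; _,_; proj₁; proj₂)
open import Data.Product.Function.NonDependent.Propositional using (_×-⇔_)
open import Data.Sum.Function.Propositional using (_⊎-⇔_)
open import Data.Sum as ⊎ using (_⊎_)
open import Data.Empty using (⊥; ⊥-elim)
open import Function using (_∘_)
open import Function.Bundles using (_⇔_; mk⇔; Equivalence)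
open import Function.Related.TypeIsomorphisms using (→-cong-⇔)
import Function.Properties.Equivalence as ⇔
open import Relation.Binary.Definitions using (Decidable)
open import Relation.Nullary using (¬_; Dec; yes; no; does; contradiction)
open import Relation.Nullary.Decidable using (_×-dec_; _⊎-dec_; _→-dec_)
open import Relation.Binary.PropositionalEquality
  using (_≡_; _≢_; refl; sym; trans; cong; cong₂)

open Equivalence using (to; from)

sub-∘ₛ : ∀ σ τ B → sub (σ ∘ₛ τ) B ≡ sub σ (sub τ B)
sub-∘ₛ σ τ (var x)  = refl
sub-∘ₛ σ τ (par p)  = refl
sub-∘ₛ σ τ ⊥'       = refl
sub-∘ₛ σ τ (A ∧' B) = cong₂ _∧'_ (sub-∘ₛ σ τ A) (sub-∘ₛ σ τ B)
sub-∘ₛ σ τ (A ∨' B) = cong₂ _∨'_ (sub-∘ₛ σ τ A) (sub-∘ₛ σ τ B)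
sub-∘ₛ σ τ (A ⇒ B)  = cong₂ _⇒_ (sub-∘ₛ σ τ A) (sub-∘ₛ σ τ B)

sub-idSub : ∀ B → sub idSub B ≡ B
sub-idSub (var x)  = refl
sub-idSub (par p)  = refl
sub-idSub ⊥'       = refl
sub-idSub (A ∧' B) = cong₂ _∧'_ (sub-idSub A) (sub-idSub B)
sub-idSub (A ∨' B) = cong₂ _∨'_ (sub-idSub A) (sub-idSub B)
sub-idSub (A ⇒ B)  = cong₂ _⇒_ (sub-idSub A) (sub-idSub B)

θ≡foldr-map : ∀ A k Xs → θ A k Xs ≡ foldr _∘ₛ_ idSub (map (λ Z → θ^ Z A) (tabulate Xs))
θ≡foldr-map A k Xs = cong (foldr _∘ₛ_ idSub) (sym (map-tabulate Xs (λ Z → θ^ Z A)))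

∀-cong-⇔ : {I : Set} {Q P P′ : I → Set} →
           (∀ i → Q i → P i ⇔ P′ i) → (∀ i → Q i → P i) ⇔ (∀ i → Q i → P′ i)
∀-cong-⇔ P⇔P′ = mk⇔ (λ h i q → to (P⇔P′ i q) (h i q)) (λ h i q → from (P⇔P′ i q) (h i q))

cong-≡true : {b c : Bool} → b ≡ c → (b ≡ true) ⇔ (c ≡ true)
cong-≡true b≡c = mk⇔ (trans (sym b≡c)) (trans b≡c)

-- Forcing over a fixed frame and a fixed persistent valuation of the parameters, with
-- Set-valued valuations of the variables, so that V⟨σ⟩ below is again a valuation.
module Semantics (F : Frame) (pv : ℕ → Node F → Bool)
  (pv-persistent : ∀ p u v → R F u v ≡ true → pv p u ≡ true → pv p v ≡ true) where

  _≼_ : Node F → Node F → Set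
  u ≼ v = R F u v ≡ true

  Valuation : Set₁
  Valuation = ℕ → Node F → Set

  ⟦_⟧ : (ℕ → Node F → Bool) → Valuation
  ⟦ b ⟧ x w = b x w ≡ true

  infix 2 _⊩[_]_
  _⊩[_]_ : Node F → Valuation → Fm → Set
  w ⊩[ V ] var x  = V x w
  w ⊩[ V ] par p  = pv p w ≡ true
  w ⊩[ V ] ⊥'     = ⊥
  w ⊩[ V ] A ∧' B = (w ⊩[ V ] A) × (w ⊩[ V ] B)
  w ⊩[ V ] A ∨' B = (w ⊩[ V ] A) ⊎ (w ⊩[ V ] B)
  w ⊩[ V ] A ⇒ B  = ∀ v → w ≼ v → v ⊩[ V ] A → v ⊩[ V ] B

  Persistent : Valuation → Set
  Persistent V = ∀ x u v → u ≼ v → V x u → V x v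

  infixl 5 _⟨_⟩
  _⟨_⟩ : Valuation → Sub → Valuation
  (V ⟨ σ ⟩) x w = w ⊩[ V ] σ x

  infix 4 _≈_ _≈⁻_
  _≈_ _≈⁻_ : Valuation → Valuation → Set
  V ≈ V′  = ∀ x w → V x w ⇔ V′ x w
  V ≈⁻ V′ = ∀ x w → w ≢ root F → V x w ⇔ V′ x w

  ⊩-model : (M : Model F) → (∀ p w → pval M p w ≡ pv p w) →
            ∀ B w → (M ∣ w ⊩ B) ⇔ (w ⊩[ ⟦ vval M ⟧ ] B)
  ⊩-model M pv≡ (var x)  w = ⇔.refl
  ⊩-model M pv≡ (par p)  w = cong-≡true (pv≡ p w)
  ⊩-model M pv≡ ⊥'       w = ⇔.refl
  ⊩-model M pv≡ (A ∧' B) w = ⊩-model M pv≡ A w ×-⇔ ⊩-model M pv≡ B w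
  ⊩-model M pv≡ (A ∨' B) w = ⊩-model M pv≡ A w ⊎-⇔ ⊩-model M pv≡ B w
  ⊩-model M pv≡ (A ⇒ B)  w =
    ∀-cong-⇔ λ v _ → →-cong-⇔ (⊩-model M pv≡ A v) (⊩-model M pv≡ B v)

  ⟦⟧-decidable : ∀ b → Decidable ⟦ b ⟧
  ⟦⟧-decidable b x w = b x w ≟ true

  ⊩-persistent : ∀ {V} → Persistent V → ∀ B u v → u ≼ v → u ⊩[ V ] B → v ⊩[ V ] B
  ⊩-persistent V-pers (var x)  u v u≼v = V-pers x u v u≼v
  ⊩-persistent V-pers (par p)  u v u≼v = pv-persistent p u v u≼v
  ⊩-persistent V-pers ⊥'       u v u≼v ()
  ⊩-persistent V-pers (A ∧' B) u v u≼v (a , b) =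
    ⊩-persistent V-pers A u v u≼v a , ⊩-persistent V-pers B u v u≼v b
  ⊩-persistent V-pers (A ∨' B) u v u≼v =
    ⊎.map (⊩-persistent V-pers A u v u≼v) (⊩-persistent V-pers B u v u≼v)
  ⊩-persistent V-pers (A ⇒ B)  u v u≼v h t v≼t = h t (transR F u v t u≼v v≼t)

  ⊩-dec : ∀ {V} → Decidable V → ∀ B w → Dec (w ⊩[ V ] B)
  ⊩-dec V-dec (var x)  w = V-dec x w
  ⊩-dec V-dec (par p)  w = pv p w ≟ true
  ⊩-dec V-dec ⊥'       w = no λ ()
  ⊩-dec V-dec (A ∧' B) w = ⊩-dec V-dec A w ×-dec ⊩-dec V-dec B w
  ⊩-dec V-dec (A ∨' B) w = ⊩-dec V-dec A w ⊎-dec ⊩-dec V-dec B w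
  ⊩-dec V-dec (A ⇒ B)  w =
    all? λ v → (R F w v ≟ true) →-dec (⊩-dec V-dec A v →-dec ⊩-dec V-dec B v)

  ⟨⟩-persistent : ∀ {V} → Persistent V → ∀ σ → Persistent (V ⟨ σ ⟩)
  ⟨⟩-persistent V-pers σ x = ⊩-persistent V-pers (σ x)

  ⟨⟩-decidable : ∀ {V} → Decidable V → ∀ σ → Decidable (V ⟨ σ ⟩)
  ⟨⟩-decidable V-dec σ x = ⊩-dec V-dec (σ x)

  ⊩-sub : ∀ {V} σ B w → (w ⊩[ V ] sub σ B) ⇔ (w ⊩[ V ⟨ σ ⟩ ] B)
  ⊩-sub σ (var x)  w = ⇔.refl
  ⊩-sub σ (par p)  w = ⇔.refl
  ⊩-sub σ ⊥'       w = ⇔.refl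
  ⊩-sub σ (A ∧' B) w = ⊩-sub σ A w ×-⇔ ⊩-sub σ B w
  ⊩-sub σ (A ∨' B) w = ⊩-sub σ A w ⊎-⇔ ⊩-sub σ B w
  ⊩-sub σ (A ⇒ B)  w = ∀-cong-⇔ λ v _ → →-cong-⇔ (⊩-sub σ A v) (⊩-sub σ B v)

  ⊩-sub-foldr : ∀ {V} σs B w →
                (w ⊩[ V ] sub (foldr _∘ₛ_ idSub σs) B) ⇔ (w ⊩[ foldl _⟨_⟩ V σs ] B)
  ⊩-sub-foldr []       B w rewrite sub-idSub B = ⇔.refl
  ⊩-sub-foldr (σ ∷ σs) B w rewrite sub-∘ₛ σ (foldr _∘ₛ_ idSub σs) B =
    ⇔.trans (⊩-sub σ (sub (foldr _∘ₛ_ idSub σs) B) w) (⊩-sub-foldr σs B w)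

  ⊩-cong-cone : ∀ {V V′} B w → (∀ x → x ∈ vars B → ∀ v → w ≼ v → V x v ⇔ V′ x v) →
                (w ⊩[ V ] B) ⇔ (w ⊩[ V′ ] B)
  ⊩-cong-cone (var x)  w agree = agree x (here refl) w (reflR F w)
  ⊩-cong-cone (par p)  w agree = ⇔.refl
  ⊩-cong-cone ⊥'       w agree = ⇔.refl
  ⊩-cong-cone (A ∧' B) w agree =
    ⊩-cong-cone A w (λ x → agree x ∘ ∈-++⁺ˡ) ×-⇔ ⊩-cong-cone B w (λ x → agree x ∘ ∈-++⁺ʳ (vars A))
  ⊩-cong-cone (A ∨' B) w agree =
    ⊩-cong-cone A w (λ x → agree x ∘ ∈-++⁺ˡ) ⊎-⇔ ⊩-cong-cone B w (λ x → agree x ∘ ∈-++⁺ʳ (vars A))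
  ⊩-cong-cone (A ⇒ B)  w agree = ∀-cong-⇔ λ v w≼v →
    →-cong-⇔ (⊩-cong-cone A v λ x x∈A u v≼u → agree x (∈-++⁺ˡ x∈A) u (transR F w v u w≼v v≼u))
             (⊩-cong-cone B v λ x x∈B u v≼u → agree x (∈-++⁺ʳ (vars A) x∈B) u (transR F w v u w≼v v≼u))

  ≢root-upward : ∀ w v → w ≢ root F → w ≼ v → v ≢ root F
  ≢root-upward w v w≢r w≼v refl = w≢r (antisym F w (root F) w≼v (rootMin F w))

  ⊩-cong : ∀ {V V′} → V ≈ V′ → ∀ B w → (w ⊩[ V ] B) ⇔ (w ⊩[ V′ ] B)
  ⊩-cong V≈V′ B w = ⊩-cong-cone B w λ y _ v _ → V≈V′ y v

  ⟨⟩-cong : ∀ {V V′} → V ≈ V′ → ∀ σ → V ⟨ σ ⟩ ≈ V′ ⟨ σ ⟩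
  ⟨⟩-cong V≈V′ σ x = ⊩-cong V≈V′ (σ x)

  foldl-⟨⟩-cong : ∀ {V V′} → V ≈ V′ → ∀ σs → foldl _⟨_⟩ V σs ≈ foldl _⟨_⟩ V′ σs
  foldl-⟨⟩-cong V≈V′ []       = V≈V′
  foldl-⟨⟩-cong V≈V′ (σ ∷ σs) = foldl-⟨⟩-cong (⟨⟩-cong V≈V′ σ) σs

  ⊩-cong⁻ : ∀ {V V′} → V ≈⁻ V′ → ∀ B w → w ≢ root F → (w ⊩[ V ] B) ⇔ (w ⊩[ V′ ] B)
  ⊩-cong⁻ V≈⁻V′ B w w≢r = ⊩-cong-cone B w λ y _ v w≼v → V≈⁻V′ y v (≢root-upward w v w≢r w≼v)

  ⟨⟩-cong⁻ : ∀ {V V′} → V ≈⁻ V′ → ∀ σ → V ⟨ σ ⟩ ≈⁻ V′ ⟨ σ ⟩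
  ⟨⟩-cong⁻ V≈⁻V′ σ x = ⊩-cong⁻ V≈⁻V′ (σ x)

  ⇒-at-root : ∀ {V} A B → ¬ (root F ⊩[ V ] A) →
              (root F ⊩[ V ] A ⇒ B) ⇔ (∀ v → v ≢ root F → v ⊩[ V ] A → v ⊩[ V ] B)
  ⇒-at-root A B r⊮A = mk⇔ (λ h v _ → h v (rootMin F v)) from-non-root
    where
      from-non-root : _ → root F ⊩[ _ ] A ⇒ B
      from-non-root h v _ v⊩A with v ≟ᶠ root F
      ... | yes refl = contradiction v⊩A r⊮A
      ... | no v≢r   = h v v≢r v⊩A

  module _ (A : Fm) where

    θ^* : List VarSet → List Sub
    θ^* = map (λ Z → θ^ Z A)

    θ^-fixes : ∀ {W} → Persistent W → ∀ Z {v} → v ⊩[ W ] A → ∀ x → (W ⟨ θ^ Z A ⟩) x v ⇔ W x v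
    θ^-fixes W-pers Z {v} v⊩A x with Z x
    ... | true  = mk⇔ (λ h → h v (reflR F v) v⊩A) (λ Wxv u v≼u _ → W-pers x v u v≼u Wxv)
    ... | false = mk⇔ proj₂ (v⊩A ,_)

    θ^-preserves : ∀ {W} → Persistent W → ∀ Z w → w ⊩[ W ] A → w ⊩[ W ⟨ θ^ Z A ⟩ ] A
    θ^-preserves W-pers Z w w⊩A = from (⊩-cong-cone A w λ x _ v w≼v →
      θ^-fixes W-pers Z (⊩-persistent W-pers A w v w≼v w⊩A) x) w⊩A

    θ^*-preserves : ∀ {W} → Persistent W → ∀ Zs w → w ⊩[ W ] A → w ⊩[ foldl _⟨_⟩ W (θ^* Zs) ] A
    θ^*-preserves W-pers []       w w⊩A = w⊩A
    θ^*-preserves W-pers (Z ∷ Zs) w w⊩A =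
      θ^*-preserves (⟨⟩-persistent W-pers (θ^ Z A)) Zs w (θ^-preserves W-pers Z w w⊩A)

    θ^-merges : ∀ {W W′} → ¬ (root F ⊩[ W ] A) → ¬ (root F ⊩[ W′ ] A) → W ≈⁻ W′ →
                ∀ Z → W ⟨ θ^ Z A ⟩ ≈ W′ ⟨ θ^ Z A ⟩
    θ^-merges r⊮A r⊮′A W≈⁻W′ Z x w with w ≟ᶠ root F
    ... | no w≢r = ⟨⟩-cong⁻ W≈⁻W′ (θ^ Z A) x w w≢r
    ... | yes refl with Z x
    ...   | true  = ⇔.trans (⇒-at-root A (var x) r⊮A)
                      (⇔.trans (∀-cong-⇔ λ v v≢r → →-cong-⇔ (⊩-cong⁻ W≈⁻W′ A v v≢r) (W≈⁻W′ x v v≢r))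
                               (⇔.sym (⇒-at-root A (var x) r⊮′A)))
    ...   | false = mk⇔ (⊥-elim ∘ r⊮A ∘ proj₁) (⊥-elim ∘ r⊮′A ∘ proj₁)

    IsRootSet : Valuation → VarSet → Set
    IsRootSet V Z = ∀ x → x ∈ vars A → (Z x ≡ true) ⇔ V x (root F)

    root-set-enumerated : ∀ {n} (Xs : Fin n → VarSet) →
                          (∀ Y → SubsetOfVars Y A → ∃ λ i → ∀ x → Xs i x ≡ Y x) →
                          (b : ℕ → Node F → Bool) → Any (IsRootSet ⟦ b ⟧) (tabulate Xs)
    root-set-enumerated Xs complete b =
      let i , Xi≗Y = complete Y Y⊆vars
      in tabulate⁺ i λ x x∈A → cong-≡true (trans (Xi≗Y x) (Y-on-vars x x∈A))
      where
        Y : VarSet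
        Y x = does (x ∈? vars A) ∧ b x (root F)

        Y⊆vars : SubsetOfVars Y A
        Y⊆vars x with x ∈? vars A
        ... | yes x∈A = λ _ → x∈A
        ... | no _    = λ ()

        Y-on-vars : ∀ x → x ∈ vars A → Y x ≡ b x (root F)
        Y-on-vars x x∈A with x ∈? vars A
        ... | yes _   = refl
        ... | no x∉A = contradiction x∈A x∉A

    -- V is the valuation of K′, which is fixed by every θ^Z since it forces A everywhere.
    module _ {V : Valuation} (V-pers : Persistent V) (r⊩A : root F ⊩[ V ] A) where

      θ^-tracks : ∀ {W} → W ≈⁻ V → ∀ Z → W ⟨ θ^ Z A ⟩ ≈⁻ V
      θ^-tracks W≈⁻V Z x v v≢r =
        ⇔.trans (⟨⟩-cong⁻ W≈⁻V (θ^ Z A) x v v≢r)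
                (θ^-fixes V-pers Z (⊩-persistent V-pers A (root F) v (rootMin F v) r⊩A) x)

      θ^-copies-root : ∀ {W} → ¬ (root F ⊩[ W ] A) → W ≈⁻ V →
                       ∀ Z → IsRootSet V Z → root F ⊩[ W ⟨ θ^ Z A ⟩ ] A
      θ^-copies-root {W} r⊮A W≈⁻V Z Z-root = from (⊩-cong-cone A (root F) agree) r⊩A
        where
          agree : ∀ x → x ∈ vars A → ∀ v → root F ≼ v → (W ⟨ θ^ Z A ⟩) x v ⇔ V x v
          agree x x∈A v _ with v ≟ᶠ root F
          ... | no v≢r = θ^-tracks W≈⁻V Z x v v≢r
          ... | yes refl with Z x | Z-root x x∈A
          ...   | true  | Zx⇔Vx = mk⇔ (λ _ → to Zx⇔Vx refl) λ Vxr →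
                    from (⇒-at-root A (var x) r⊮A) λ u u≢r _ →
                      from (W≈⁻V x u u≢r) (V-pers x (root F) u (rootMin F u) Vxr)
          ...   | false | Zx⇔Vx = mk⇔ (⊥-elim ∘ r⊮A ∘ proj₁) (λ Vxr → contradiction (from Zx⇔Vx Vxr) λ ())

      θ^*-reaches : ∀ {W} → Persistent W → Decidable W → W ≈⁻ V →
                    ∀ Zs → Any (IsRootSet V) Zs → root F ⊩[ foldl _⟨_⟩ W (θ^* Zs) ] A
      θ^*-reaches W-pers W-dec W≈⁻V (Z ∷ Zs) hit with ⊩-dec W-dec A (root F)
      ... | yes r⊩WA = θ^*-preserves W-pers (Z ∷ Zs) (root F) r⊩WA
      ... | no r⊮A with hit
      ...   | here Z-root = θ^*-preserves (⟨⟩-persistent W-pers (θ^ Z A)) Zs (root F)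
                              (θ^-copies-root r⊮A W≈⁻V Z Z-root)
      ...   | there hit′  = θ^*-reaches (⟨⟩-persistent W-pers (θ^ Z A)) (⟨⟩-decidable W-dec (θ^ Z A))
                              (θ^-tracks W≈⁻V Z) Zs hit′

    θ^*-reflects-root : ∀ {W W′} → Persistent W → Decidable W → Persistent W′ → Decidable W′ →
                        W ≈⁻ W′ → ∀ Z Zs → Any (IsRootSet W′) (Z ∷ Zs) →
                        root F ⊩[ foldl _⟨_⟩ W′ (θ^* (Z ∷ Zs)) ] A →
                        root F ⊩[ foldl _⟨_⟩ W (θ^* (Z ∷ Zs)) ] A
    θ^*-reflects-root W-pers W-dec W′-pers W′-dec W≈⁻W′ Z Zs hit final′⊩A
      with ⊩-dec W-dec A (root F) | ⊩-dec W′-dec A (root F)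
    ... | yes r⊩A | _         = θ^*-preserves W-pers (Z ∷ Zs) (root F) r⊩A
    ... | no r⊮A  | yes r⊩′A = θ^*-reaches W′-pers r⊩′A W-pers W-dec W≈⁻W′ (Z ∷ Zs) hit
    ... | no r⊮A  | no r⊮′A  =
      from (⊩-cong (foldl-⟨⟩-cong (θ^-merges r⊮A r⊮′A W≈⁻W′ Z) (θ^* Zs)) A (root F)) final′⊩A

lemma4p4 : (A : Fm) (k : ℕ) (Xs : Fin (suc k) → VarSet) → IsSubsetEnum A k Xs →
    (F : Frame) (K K' : Model F) →
    K ⊩⁻ sub (θ A k Xs) A → ParVariant K K' → K' ⊩ sub (θ A k Xs) A →
    K ⊩ sub (θ A k Xs) A
lemma4p4 A k Xs (_ , complete , _) F K K' K⊩⁻ (same-off-root , same-par-at-root) K'⊩ w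
  with w ≟ᶠ root F
... | no w≢r   = K⊩⁻ w w≢r
... | yes refl =
  from (θ-at-root K λ _ _ → refl)
    (θ^*-reflects-root A (vpers K) (⟦⟧-decidable _) (vpers K') (⟦⟧-decidable _) K≈⁻K' (Xs zero) _
       (root-set-enumerated A Xs complete (vval K'))
       (to (θ-at-root K' same-par) (K'⊩ (root F))))
  where
    open Semantics F (pval K) (ppers K)

    θ-at-root : (M : Model F) → (∀ p w → pval M p w ≡ pval K p w) →
                (M ∣ root F ⊩ sub (θ A k Xs) A) ⇔
                (root F ⊩[ foldl _⟨_⟩ ⟦ vval M ⟧ (θ^* A (tabulate Xs)) ] A)
    θ-at-root M same rewrite θ≡foldr-map A k Xs =
      ⇔.trans (⊩-model M same _ (root F)) (⊩-sub-foldr (θ^* A (tabulate Xs)) A (root F))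

    same-par : ∀ p w → pval K' p w ≡ pval K p w
    same-par p w with w ≟ᶠ root F
    ... | yes refl = same-par-at-root p
    ... | no w≢r   = proj₂ (same-off-root w w≢r) p

    K≈⁻K' : ⟦ vval K ⟧ ≈⁻ ⟦ vval K' ⟧
    K≈⁻K' x w w≢r = cong-≡true (sym (proj₁ (same-off-root w w≢r) x))
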